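{- Let $G$ be an additive abelian group of order $v$ and let $D_1,D_2$ be two sets of size $\frac{v-1}{2}$ which partition $G\setminus\{0\}$. Then $\{D_1,D_2\}$ is a strong external difference family in $G$ (for some $\lambda$) if and only if $D_1$ is a Paley-type partial difference set in $G$; moreover, in that case $D_2$ is also a Paley-type partial difference set in $G$.
   Context: A $k$-element subset $D$ of an additive group $G$ of order $v$ is a $(v,k,\lambda,\mu)$ partial difference set (PDS) if the multiset $\{d_1-d_2 : d_1,d_2\in D,\ d_1\neq d_2\}$ contains each non-identity element of $D$ exactly $\lambda$ times and each non-identity element of $G\setminus D$ exactly $\mu$ times. A PDS $D$ is regular if $0\notin D$ and $D=-D$. A regular PDS with parameters $\left(v,\frac{v-1}{2},\frac{v-5}{4},\frac{v-1}{4}\right)$, where $v\equiv 1\pmod 4$, is said to be of Paley type. For disjoint subsets $A,B$ of an additive abelian group $G$, let $\mathcal{D}(A,B)$ denote the multiset $\{x-y : x\in A,\ y\in B\}$. An $(n,m,k,\lambda)$-strong external difference family (SEDF) in an additive abelian group $G$ of order $n$ is a set of $m\geq 2$ pairwise disjoint $k$-subsets $A_1,\dots,A_m$ of $G$ such that for every $i$, the multiset union $\bigcup_{j\neq i}\mathcal{D}(A_i,A_j)$ contains every nonzero element of $G$ exactly $\lambda$ times. -}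

module Defs where

open import Level using (0ℓ)
import Data.Nat as ℕ
open import Data.Nat using (ℕ; _∸_; _≤_)
open import Data.Fin using (Fin)
import Data.Fin as Fin
open import Data.Fin.Properties using () renaming (_≟_ to _≟ᶠ_)
open import Data.List using (List; length; filter; cartesianProduct; map; allFin)
open import Data.Nat.ListAction using (sum)
open import Data.List.Membership.Propositional using (_∈_)
open import Data.List.Relation.Unary.Unique.Propositional using (Unique)
open import Data.Product using (_×_; _,_; Σ; ∃)
open import Relation.Nullary using (¬_)
open import Relation.Nullary.Decidable using (_×-dec_; ¬?)
open import Relation.Binary.Definitions using (DecidableEquality)
open import Relation.Binary.PropositionalEquality using (_≡_; _≢_)
open import Relation.Unary using (Pred; Decidable)
open import Algebra.Structures using (IsAbelianGroup)
open import Function.Bundles using (_⇔_)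

record FiniteAbelianGroup : Set₁ where
  infixl 6 _+_ _-_
  field
    Carrier        : Set
    _+_            : Carrier → Carrier → Carrier
    0#             : Carrier
    -_             : Carrier → Carrier
    isAbelianGroup : IsAbelianGroup _≡_ _+_ 0# -_
    _≟_            : DecidableEquality Carrier
    elems          : List Carrier
    elems-complete : ∀ x → x ∈ elems
    elems-unique   : Unique elems

  _-_ : Carrier → Carrier → Carrier
  x - y = x + (- y)

  order : ℕ
  order = length elems

record Subset (G : FiniteAbelianGroup) : Set₁ where
  open FiniteAbelianGroup G
  field
    _∋_  : Pred Carrier 0ℓ
    _∋?_ : Decidable _∋_

module _ {G : FiniteAbelianGroup} where
  open FiniteAbelianGroup G
  open Subset

  size : Subset G → ℕ
  size D = length (filter (D ∋?_) elems)

  internalDiffCount : Subset G → Carrier → ℕ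
  internalDiffCount D g =
    length (filter (λ p → let (x , y) = p in
                     (D ∋? x) ×-dec ((D ∋? y) ×-dec (¬? (x ≟ y) ×-dec ((x - y) ≟ g))))
                   (cartesianProduct elems elems))

  externalDiffCount : Subset G → Subset G → Carrier → ℕ
  externalDiffCount A B g =
    length (filter (λ p → let (x , y) = p in
                     (A ∋? x) ×-dec ((B ∋? y) ×-dec ((x - y) ≟ g)))
                   (cartesianProduct elems elems))

  IsPDS : Subset G → ℕ → ℕ → ℕ → ℕ → Set
  IsPDS D v k lam mu =
    order ≡ v × size D ≡ k
    × (∀ g → g ≢ 0# → D ∋ g → internalDiffCount D g ≡ lam)
    × (∀ g → g ≢ 0# → ¬ (D ∋ g) → internalDiffCount D g ≡ mu)

  IsRegular : Subset G → Set
  IsRegular D = ¬ (D ∋ 0#) × (∀ x → (D ∋ x) ⇔ (D ∋ (- x)))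

  -- Paley type: v ≡ 1 (mod 4), i.e. v = 4n+1, and D is a regular
  -- (v, (v-1)/2, (v-5)/4, (v-1)/4) = (4n+1, 2n, n-1, n) PDS.
  IsPaleyPDS : Subset G → Set
  IsPaleyPDS D = Σ ℕ λ n → order ≡ 4 ℕ.* n ℕ.+ 1 × IsRegular D × IsPDS D order (2 ℕ.* n) (n ∸ 1) n

  IsSEDF : (n m k lam : ℕ) → (Fin m → Subset G) → Set
  IsSEDF n m k lam A =
    order ≡ n × 2 ≤ m
    × (∀ i j → i ≢ j → ∀ x → ¬ ((A i ∋ x) × (A j ∋ x)))
    × (∀ i → size (A i) ≡ k)
    × (∀ i g → g ≢ 0# →
         sum (map (λ j → externalDiffCount (A i) (A j) g)
                  (filter (λ j → ¬? (j ≟ᶠ i)) (allFin m))) ≡ lam)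

pairFamily : {G : FiniteAbelianGroup} → Subset G → Subset G → Fin 2 → Subset G
pairFamily A B Fin.zero = A
pairFamily A B (Fin.suc _) = B

module Submission where

open import Defs
open import Data.Nat using (ℕ; _∸_; _/_)
open import Data.Fin using (Fin)
open import Data.Product using (_×_; Σ)
open import Data.Sum using (_⊎_)
open import Relation.Nullary using (¬_)
open import Relation.Binary.PropositionalEquality using (_≡_; _≢_)
open import Function.Bundles using (_⇔_)

open import Level using (0ℓ)
open import Data.Nat using (zero; suc; _+_; _*_; _≤_; s≤s; z≤n)
open import Data.Nat.Properties
  using (+-commutativeSemigroup; +-assoc; +-identityʳ; *-zeroʳ; *-identityʳ; *-distribˡ-+; *-distribʳ-+;
         +-cancelˡ-≡; +-cancelʳ-≡; *-cancelʳ-≡; m+n≡0⇒n≡0; ≤-trans; m≤n+m; m≤m+n; n≤0⇒n≡0)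
open import Data.Nat.Tactic.RingSolver using (solve-∀)
open import Data.Nat.ListAction using (sum)
open import Data.Nat.ListAction.Properties using (sum-++)
import Data.Fin as Fin
open import Data.List using (List; []; _∷_; map; filter; length; cartesianProduct; allFin; _++_)
open import Data.Fin.Properties using () renaming (_≟_ to _≟ᶠ_)
open import Data.List.Properties using (map-cong; map-++; map-∘; filter-all; filter-≐)
open import Data.List.Membership.Propositional using (_∈_)
open import Data.List.Relation.Unary.Any using (here; there)
open import Data.List.Relation.Unary.All as All using (All; []; _∷_)
open import Data.List.Relation.Unary.AllPairs using (_∷_)
open import Data.List.Relation.Unary.Unique.Propositional using (Unique)
open import Data.Product using (_,_; proj₁; proj₂)
open import Data.Sum using (inj₁; inj₂)
import Data.Sum as Sum
open import Data.Empty using (⊥; ⊥-elim)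
open import Data.Unit using (⊤; tt)
open import Relation.Nullary using (Dec; yes; no)
open import Relation.Nullary.Decidable using (_×-dec_; _⊎-dec_; ¬?)
open import Relation.Unary using (Pred; Decidable)
open import Relation.Binary.PropositionalEquality
  using (refl; sym; trans; cong; cong₂; subst; subst₂; module ≡-Reasoning)
open import Function using (id; _∘_)
open import Function.Bundles using (Equivalence; mk⇔)
open import Algebra.Bundles using (AbelianGroup)
open import Algebra.Structures using (IsAbelianGroup)
import Algebra.Properties.AbelianGroup as AbelianGroupProperties
open import Algebra.Properties.CommutativeSemigroup +-commutativeSemigroup using (interchange)

-- Write I_A(g) for the number of pairs of distinct elements of A with
-- difference g, and E_{A,B}(g) for the multiplicity of g in 𝒟(A,B).  For
-- complementary A, B (a partition of G ∖ {0}) and g ≠ 0, every a ∈ A has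
-- a - g in exactly one of A, B, {0}, the last iff a = g; this gives the
-- counting identity  I_A(g) + E_{A,B}(g) + [g ∈ A] = |A|.  So if |A| = 2n,
-- E_{A,B} is constantly n on G ∖ {0} iff A has PDS parameters λ = n-1,
-- μ = n, and constancy of E_{A,B} forces A = -A (compare g with -g).  An
-- SEDF {A, B} says E_{A,B} is a constant λ; double counting
-- Σ_g E_{A,B}(g) = |A||B| gives s² = 2λs, so s = 2λ.  Finally
-- E_{B,A}(g) = E_{A,B}(-g) passes constancy from D₁ to D₂.

𝟙 : {P : Set} → Dec P → ℕ
𝟙 (yes _) = 1
𝟙 (no _)  = 0

module _ {P : Set} where

  𝟙-yes : (d : Dec P) → P → 𝟙 d ≡ 1
  𝟙-yes (yes _) _ = refl
  𝟙-yes (no ¬p) p = ⊥-elim (¬p p)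

  𝟙-no : (d : Dec P) → ¬ P → 𝟙 d ≡ 0
  𝟙-no (yes p) ¬p = ⊥-elim (¬p p)
  𝟙-no (no _)  _  = refl

module _ {P Q : Set} where

  𝟙-⇔ : (d : Dec P) (e : Dec Q) → (P → Q) → (Q → P) → 𝟙 d ≡ 𝟙 e
  𝟙-⇔ (yes _) (yes _) _   _   = refl
  𝟙-⇔ (no _)  (no _)  _   _   = refl
  𝟙-⇔ (yes p) (no ¬q) p→q _   = ⊥-elim (¬q (p→q p))
  𝟙-⇔ (no ¬p) (yes q) _   q→p = ⊥-elim (¬p (q→p q))

  𝟙-transfer : (d : Dec P) (e : Dec Q) → 𝟙 d ≡ 𝟙 e → P → Q
  𝟙-transfer (yes _) (yes q) _  _ = q
  𝟙-transfer (yes _) (no _)  () _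
  𝟙-transfer (no ¬p) _       _  p = ⊥-elim (¬p p)

  𝟙-× : (d : Dec P) (e : Dec Q) → 𝟙 (d ×-dec e) ≡ 𝟙 d * 𝟙 e
  𝟙-× (yes _) (yes _) = refl
  𝟙-× (yes _) (no _)  = refl
  𝟙-× (no _)  _       = refl

  𝟙-⊎ : (d : Dec P) (e : Dec Q) → (P → Q → ⊥) → 𝟙 (d ⊎-dec e) ≡ 𝟙 d + 𝟙 e
  𝟙-⊎ (yes p) (yes q) excl = ⊥-elim (excl p q)
  𝟙-⊎ (yes _) (no _)  _    = refl
  𝟙-⊎ (no _)  (yes _) _    = refl
  𝟙-⊎ (no _)  (no _)  _    = refl

IsDisjointUnion : {A : Set} → Pred A 0ℓ → Pred A 0ℓ → Pred A 0ℓ → Set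
IsDisjointUnion T T₁ T₂ = (∀ x → ¬ (T₁ x × T₂ x)) × (∀ x → T x ⇔ (T₁ x ⊎ T₂ x))

𝟙-disjointUnion : {A : Set} {T T₁ T₂ : Pred A 0ℓ} (T? : Decidable T) (T₁? : Decidable T₁) (T₂? : Decidable T₂) →
  IsDisjointUnion T T₁ T₂ → ∀ x → 𝟙 (T? x) ≡ 𝟙 (T₁? x) + 𝟙 (T₂? x)
𝟙-disjointUnion T? T₁? T₂? (disjoint , union) x =
  trans (𝟙-⇔ (T? x) (T₁? x ⊎-dec T₂? x) (Equivalence.to (union x)) (Equivalence.from (union x)))
        (𝟙-⊎ (T₁? x) (T₂? x) (λ p q → disjoint x (p , q)))

∑ : {A : Set} → List A → (A → ℕ) → ℕ
∑ xs f = sum (map f xs)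

syntax ∑ xs (λ x → e) = ∑[ x ← xs ] e

module _ {A : Set} where

  ∑-cong : {f g : A → ℕ} → (∀ x → f x ≡ g x) → ∀ xs → ∑ xs f ≡ ∑ xs g
  ∑-cong f≗g xs = cong sum (map-cong f≗g xs)

  ∑-+ : (f g : A → ℕ) (xs : List A) → ∑[ x ← xs ] (f x + g x) ≡ ∑ xs f + ∑ xs g
  ∑-+ f g [] = refl
  ∑-+ f g (x ∷ xs) =
    trans (cong (f x + g x +_) (∑-+ f g xs)) (interchange (f x) (g x) (∑ xs f) (∑ xs g))

  ∑-*ˡ : (c : ℕ) (f : A → ℕ) (xs : List A) → ∑[ x ← xs ] (c * f x) ≡ c * ∑ xs f
  ∑-*ˡ c f []       = sym (*-zeroʳ c)
  ∑-*ˡ c f (x ∷ xs) = trans (cong (c * f x +_) (∑-*ˡ c f xs)) (sym (*-distribˡ-+ c (f x) _))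

  ∑-*ʳ : (f : A → ℕ) (c : ℕ) (xs : List A) → ∑[ x ← xs ] (f x * c) ≡ ∑ xs f * c
  ∑-*ʳ f c []       = refl
  ∑-*ʳ f c (x ∷ xs) = trans (cong (f x * c +_) (∑-*ʳ f c xs)) (sym (*-distribʳ-+ c (f x) _))

  ∑-zero : (xs : List A) → ∑[ x ← xs ] 0 ≡ 0
  ∑-zero []       = refl
  ∑-zero (_ ∷ xs) = ∑-zero xs

module _ {A B : Set} where

  ∑-swap : (f : A → B → ℕ) (xs : List A) (ys : List B) →
    ∑[ x ← xs ] ∑[ y ← ys ] f x y ≡ ∑[ y ← ys ] ∑[ x ← xs ] f x y
  ∑-swap f []       ys = sym (∑-zero ys)
  ∑-swap f (x ∷ xs) ys =
    trans (cong (∑ ys (f x) +_) (∑-swap f xs ys)) (sym (∑-+ (f x) (λ y → ∑[ x ← xs ] f x y) ys))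

  ∑-cartesianProduct : (f : A × B → ℕ) (xs : List A) (ys : List B) →
    ∑ (cartesianProduct xs ys) f ≡ ∑[ x ← xs ] ∑[ y ← ys ] f (x , y)
  ∑-cartesianProduct f []       ys = refl
  ∑-cartesianProduct f (x ∷ xs) ys = begin
    sum (map f (map (x ,_) ys ++ cartesianProduct xs ys))
      ≡⟨ cong sum (map-++ f (map (x ,_) ys) _) ⟩
    sum (map f (map (x ,_) ys) ++ map f (cartesianProduct xs ys))
      ≡⟨ sum-++ (map f (map (x ,_) ys)) _ ⟩
    sum (map f (map (x ,_) ys)) + ∑ (cartesianProduct xs ys) f
      ≡⟨ cong₂ _+_ (cong sum (sym (map-∘ ys))) (∑-cartesianProduct f xs ys) ⟩
    ∑[ y ← ys ] f (x , y) + ∑[ x ← xs ] ∑[ y ← ys ] f (x , y)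
      ∎
    where open ≡-Reasoning

module _ {A : Set} {P : Pred A 0ℓ} (P? : Decidable P) where

  length-filter≡∑𝟙 : (xs : List A) → length (filter P? xs) ≡ ∑[ x ← xs ] 𝟙 (P? x)
  length-filter≡∑𝟙 [] = refl
  length-filter≡∑𝟙 (x ∷ xs) with P? x
  ... | yes _ = cong suc (length-filter≡∑𝟙 xs)
  ... | no _  = length-filter≡∑𝟙 xs

  ∑𝟙-none : {xs : List A} → All (λ x → ¬ P x) xs → ∑[ x ← xs ] 𝟙 (P? x) ≡ 0
  ∑𝟙-none []          = refl
  ∑𝟙-none {x ∷ _} (¬p ∷ ¬ps) = cong₂ _+_ (𝟙-no (P? x) ¬p) (∑𝟙-none ¬ps)

  ∑𝟙-point : {c : A} → (∀ x → P x → x ≡ c) →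
    {xs : List A} → c ∈ xs → Unique xs → ∑[ x ← xs ] 𝟙 (P? x) ≡ 𝟙 (P? c)
  ∑𝟙-point {c} only (here refl) (c∉xs ∷ _) =
    trans (cong (𝟙 (P? c) +_) (∑𝟙-none (All.map (λ c≢x p → c≢x (sym (only _ p))) c∉xs)))
          (+-identityʳ _)
  ∑𝟙-point only {x ∷ _} (there c∈xs) (x∉xs ∷ unique) =
    cong₂ _+_ (𝟙-no (P? x) (λ p → All.lookup x∉xs c∈xs (only x p))) (∑𝟙-point only c∈xs unique)

exchange : ∀ a b c d → a + b ≡ c + d → (a ≡ c) ⇔ (b ≡ d)
exchange a b c d eq = mk⇔ (λ { refl → +-cancelˡ-≡ a b d eq }) (λ { refl → +-cancelʳ-≡ b a c eq })

balance-in : ∀ a b n → a + b + 1 ≡ 2 * n → a + b ≡ (n ∸ 1) + n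
balance-in a b zero eq with () ← m+n≡0⇒n≡0 (a + b) eq
balance-in a b (suc m) eq = +-cancelʳ-≡ 1 _ _ (trans eq (twice-suc m))
  where
  twice-suc : ∀ m → 2 * suc m ≡ m + suc m + 1
  twice-suc = solve-∀

balance-out : ∀ a b n → a + b + 0 ≡ 2 * n → a + b ≡ n + n
balance-out a b n eq = trans (sym (+-identityʳ (a + b))) (trans eq (cong (n +_) (+-identityʳ n)))

square-cancel : ∀ s lam → s * s ≡ lam * (s + s) → s ≡ 0 ⊎ s ≡ 2 * lam
square-cancel zero    _   _  = inj₁ refl
square-cancel (suc t) lam eq = inj₂ (*-cancelʳ-≡ (suc t) (2 * lam) (suc t) (trans eq (regroup lam (suc t))))
  where
  regroup : ∀ l s → l * (s + s) ≡ 2 * l * s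
  regroup = solve-∀

twice+twice+1 : ∀ n → 2 * n + 2 * n + 1 ≡ 4 * n + 1
twice+twice+1 n = cong (_+ 1) (sym (*-distribʳ-+ n 2 2))

module Differences (G : FiniteAbelianGroup) where
  open FiniteAbelianGroup G renaming (_+_ to _⊕_)
  open Subset using (_∋_; _∋?_)
  open IsAbelianGroup isAbelianGroup using (assoc; comm; identityˡ; identityʳ; inverseʳ)

  abelianGroup : AbelianGroup 0ℓ 0ℓ
  abelianGroup = record { isAbelianGroup = isAbelianGroup }

  open AbelianGroupProperties abelianGroup
    using (⁻¹-anti-homo‿-; ⁻¹-involutive; ε⁻¹≈ε; x∙y⁻¹≈ε⇒x≈y)
  open ≡-Reasoning

  sub-sub : ∀ x g → x - (x - g) ≡ g
  sub-sub x g = begin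
    x ⊕ - (x - g)  ≡⟨ cong (x ⊕_) (⁻¹-anti-homo‿- x g) ⟩
    x ⊕ (g - x)    ≡⟨ cong (x ⊕_) (comm g (- x)) ⟩
    x ⊕ (- x ⊕ g)  ≡⟨ assoc x (- x) g ⟨
    x - x ⊕ g      ≡⟨ cong (_⊕ g) (inverseʳ x) ⟩
    0# ⊕ g         ≡⟨ identityˡ g ⟩
    g              ∎

  sub-solve : ∀ {x y g} → x - y ≡ g → y ≡ x - g
  sub-solve {x} {y} x-y≡g = trans (sym (sub-sub x y)) (cong (λ z → x - z) x-y≡g)

  sub-swap : ∀ {x y g} → x - y ≡ g → y - x ≡ - g
  sub-swap {x} {y} x-y≡g = trans (sym (⁻¹-anti-homo‿- x y)) (cong -_ x-y≡g)

  sub-unswap : ∀ {x y g} → y - x ≡ - g → x - y ≡ g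
  sub-unswap {g = g} y-x≡-g = trans (sub-swap y-x≡-g) (⁻¹-involutive g)

  sub-zero : ∀ x → x - 0# ≡ x
  sub-zero x = trans (cong (x ⊕_) ε⁻¹≈ε) (identityʳ x)

  neg≢0 : ∀ {g} → g ≢ 0# → - g ≢ 0#
  neg≢0 {g} g≢0 -g≡0 = g≢0 (trans (sym (⁻¹-involutive g)) (trans (cong -_ -g≡0) ε⁻¹≈ε))

  whole : Subset G
  whole = record { _∋_ = λ _ → ⊤ ; _∋?_ = λ _ → yes tt }

  zeroSet : Subset G
  zeroSet = record { _∋_ = _≡ 0# ; _∋?_ = _≟ 0# }

  _∪_ : Subset G → Subset G → Subset G
  A ∪ B = record { _∋_ = λ x → (A ∋ x) ⊎ (B ∋ x) ; _∋?_ = λ x → (A ∋? x) ⊎-dec (B ∋? x) }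

  record _≐_⊎_ (T T₁ T₂ : Subset G) : Set where
    constructor disjointUnion
    field
      disjoint : ∀ x → ¬ ((T₁ ∋ x) × (T₂ ∋ x))
      union    : ∀ x → (T ∋ x) ⇔ ((T₁ ∋ x) ⊎ (T₂ ∋ x))

  Diff : (A B : Subset G) (g x y : Carrier) → Set
  Diff A B g x y = (A ∋ x) × ((B ∋ y) × (x - y ≡ g))

  diff? : (A B : Subset G) (g x y : Carrier) → Dec (Diff A B g x y)
  diff? A B g x y = (A ∋? x) ×-dec ((B ∋? y) ×-dec ((x - y) ≟ g))

  ∑G : (Carrier → ℕ) → ℕ
  ∑G = ∑ elems

  pairs : List (Carrier × Carrier)
  pairs = cartesianProduct elems elems

  size≡∑ : (A : Subset G) → size A ≡ ∑G (λ x → 𝟙 (A ∋? x))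
  size≡∑ A = length-filter≡∑𝟙 (A ∋?_) elems

  external≡∑∑ : (A B : Subset G) (g : Carrier) →
    externalDiffCount A B g ≡ ∑G (λ x → ∑G (λ y → 𝟙 (diff? A B g x y)))
  external≡∑∑ A B g =
    trans (length-filter≡∑𝟙 _ pairs)
          (∑-cartesianProduct (λ p → 𝟙 (diff? A B g (proj₁ p) (proj₂ p))) elems elems)

  ∑G𝟙-point : {P : Carrier → Set} (P? : ∀ x → Dec (P x)) (c : Carrier) →
    (∀ x → P x → x ≡ c) → ∑G (λ x → 𝟙 (P? x)) ≡ 𝟙 (P? c)
  ∑G𝟙-point P? c only = ∑𝟙-point P? only (elems-complete c) elems-unique

  size-⊎ : {T T₁ T₂ : Subset G} → T ≐ T₁ ⊎ T₂ → size T ≡ size T₁ + size T₂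
  size-⊎ {T} {T₁} {T₂} (disjointUnion disjoint union) = begin
    size T                                  ≡⟨ size≡∑ T ⟩
    ∑G (λ x → 𝟙 (T ∋? x))
      ≡⟨ ∑-cong (𝟙-disjointUnion (T ∋?_) (T₁ ∋?_) (T₂ ∋?_) (disjoint , union)) elems ⟩
    ∑G (λ x → 𝟙 (T₁ ∋? x) + 𝟙 (T₂ ∋? x))    ≡⟨ ∑-+ _ _ elems ⟩
    ∑G (λ x → 𝟙 (T₁ ∋? x)) + ∑G (λ x → 𝟙 (T₂ ∋? x)) ≡⟨ cong₂ _+_ (size≡∑ T₁) (size≡∑ T₂) ⟨
    size T₁ + size T₂                       ∎

  external-⊎ʳ : (S : Subset G) {T T₁ T₂ : Subset G} → T ≐ T₁ ⊎ T₂ → ∀ g →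
    externalDiffCount S T g ≡ externalDiffCount S T₁ g + externalDiffCount S T₂ g
  external-⊎ʳ S {T} {T₁} {T₂} (disjointUnion disjoint union) g = begin
    externalDiffCount S T g                   ≡⟨ length-filter≡∑𝟙 _ pairs ⟩
    ∑ pairs (λ p → 𝟙 (d? T p))                ≡⟨ ∑-cong (𝟙-disjointUnion (d? T) (d? T₁) (d? T₂) pairUnion) pairs ⟩
    ∑ pairs (λ p → 𝟙 (d? T₁ p) + 𝟙 (d? T₂ p)) ≡⟨ ∑-+ _ _ pairs ⟩
    ∑ pairs (λ p → 𝟙 (d? T₁ p)) + ∑ pairs (λ p → 𝟙 (d? T₂ p))
      ≡⟨ cong₂ _+_ (length-filter≡∑𝟙 _ pairs) (length-filter≡∑𝟙 _ pairs) ⟨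
    externalDiffCount S T₁ g + externalDiffCount S T₂ g ∎
    where
    d? : (T : Subset G) (p : Carrier × Carrier) → Dec (Diff S T g (proj₁ p) (proj₂ p))
    d? T (x , y) = diff? S T g x y

    pairUnion : IsDisjointUnion (λ (x , y) → Diff S T g x y) (λ (x , y) → Diff S T₁ g x y) (λ (x , y) → Diff S T₂ g x y)
    pairUnion = (λ (_ , y) ((_ , t₁ , _) , (_ , t₂ , _)) → disjoint y (t₁ , t₂))
              , (λ (_ , y) → mk⇔
                  (λ (s , t , e) → Sum.map (λ t₁ → s , t₁ , e) (λ t₂ → s , t₂ , e) (Equivalence.to (union y) t))
                  (Sum.[ (λ (s , t₁ , e) → s , Equivalence.from (union y) (inj₁ t₁) , e)
                       , (λ (s , t₂ , e) → s , Equivalence.from (union y) (inj₂ t₂) , e) ]))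

  size-whole : size whole ≡ order
  size-whole = cong length (filter-all (λ _ → yes tt) (All.universal (λ _ → tt) elems))

  size-zeroSet : size zeroSet ≡ 1
  size-zeroSet = trans (size≡∑ zeroSet) (trans (∑G𝟙-point (_≟ 0#) 0# (λ _ x≡0 → x≡0)) (𝟙-yes (0# ≟ 0#) refl))

  -- Every x ∈ S is x - y = g for exactly one y ∈ G.
  external-whole : (S : Subset G) (g : Carrier) → externalDiffCount S whole g ≡ size S
  external-whole S g = begin
    externalDiffCount S whole g                  ≡⟨ external≡∑∑ S whole g ⟩
    ∑G (λ x → ∑G (λ y → 𝟙 (diff? S whole g x y))) ≡⟨ ∑-cong atPoint elems ⟩
    ∑G (λ x → 𝟙 (S ∋? x))                        ≡⟨ size≡∑ S ⟨
    size S                                       ∎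
    where
    atPoint : ∀ x → ∑G (λ y → 𝟙 (diff? S whole g x y)) ≡ 𝟙 (S ∋? x)
    atPoint x = trans (∑G𝟙-point (diff? S whole g x) (x - g) (λ _ (_ , _ , e) → sub-solve e))
                      (𝟙-⇔ (diff? S whole g x (x - g)) (S ∋? x) proj₁ (λ s → s , tt , sub-sub x g))

  -- The only way to write g as x - 0 is x = g.
  external-zeroSet : (S : Subset G) (g : Carrier) → externalDiffCount S zeroSet g ≡ 𝟙 (S ∋? g)
  external-zeroSet S g = begin
    externalDiffCount S zeroSet g                    ≡⟨ external≡∑∑ S zeroSet g ⟩
    ∑G (λ x → ∑G (λ y → 𝟙 (diff? S zeroSet g x y)))  ≡⟨ ∑-cong atZero elems ⟩
    ∑G (λ x → 𝟙 ((S ∋? x) ×-dec (x ≟ g)))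
      ≡⟨ ∑G𝟙-point (λ x → (S ∋? x) ×-dec (x ≟ g)) g (λ _ → proj₂) ⟩
    𝟙 ((S ∋? g) ×-dec (g ≟ g))                       ≡⟨ 𝟙-⇔ _ (S ∋? g) proj₁ (_, refl) ⟩
    𝟙 (S ∋? g)                                       ∎
    where
    atZero : ∀ x → ∑G (λ y → 𝟙 (diff? S zeroSet g x y)) ≡ 𝟙 ((S ∋? x) ×-dec (x ≟ g))
    atZero x = trans (∑G𝟙-point (diff? S zeroSet g x) 0# (λ _ (_ , y≡0 , _) → y≡0))
                     (𝟙-⇔ (diff? S zeroSet g x 0#) ((S ∋? x) ×-dec (x ≟ g))
                          (λ (s , _ , e) → s , trans (sym (sub-zero x)) e)
                          (λ (s , e) → s , refl , trans (sub-zero x) e))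

  -- For g ≠ 0 the condition x ≠ y in the internal count is automatic.
  internal≡external : (S : Subset G) {g : Carrier} → g ≢ 0# → internalDiffCount S g ≡ externalDiffCount S S g
  internal≡external S {g} g≢0 =
    cong length (filter-≐ internal? (λ (x , y) → diff? S S g x y) (forget , distinct) pairs)
    where
    Internal : Carrier × Carrier → Set
    Internal (x , y) = (S ∋ x) × ((S ∋ y) × (x ≢ y × (x - y ≡ g)))

    internal? : (p : Carrier × Carrier) → Dec (Internal p)
    internal? (x , y) = (S ∋? x) ×-dec ((S ∋? y) ×-dec (¬? (x ≟ y) ×-dec ((x - y) ≟ g)))

    forget : ∀ {p} → Internal p → Diff S S g (proj₁ p) (proj₂ p)
    forget (s , s′ , _ , e) = s , s′ , e

    distinct : ∀ {p} → Diff S S g (proj₁ p) (proj₂ p) → Internal p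
    distinct {x , y} (s , s′ , e) = s , s′ , (λ x≡y → g≢0 (trans (sym e) (trans (cong (_- y) x≡y) (inverseʳ y)))) , e

  -- x - y = g iff y - x = -g.
  external-swap : (A B : Subset G) (g : Carrier) → externalDiffCount A B g ≡ externalDiffCount B A (- g)
  external-swap A B g = begin
    externalDiffCount A B g                          ≡⟨ external≡∑∑ A B g ⟩
    ∑G (λ x → ∑G (λ y → 𝟙 (diff? A B g x y)))        ≡⟨ ∑-cong (λ x → ∑-cong (flip x) elems) elems ⟩
    ∑G (λ x → ∑G (λ y → 𝟙 (diff? B A (- g) y x)))    ≡⟨ ∑-swap _ elems elems ⟩
    ∑G (λ y → ∑G (λ x → 𝟙 (diff? B A (- g) y x)))    ≡⟨ external≡∑∑ B A (- g) ⟨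
    externalDiffCount B A (- g)                      ∎
    where
    flip : ∀ x y → 𝟙 (diff? A B g x y) ≡ 𝟙 (diff? B A (- g) y x)
    flip x y = 𝟙-⇔ (diff? A B g x y) (diff? B A (- g) y x)
                   (λ (a , b , e) → b , a , sub-swap e) (λ (b , a , e) → a , b , sub-unswap e)

  external-zero : (A B : Subset G) → (∀ x → ¬ ((A ∋ x) × (B ∋ x))) → externalDiffCount A B 0# ≡ 0
  external-zero A B disjoint =
    trans (length-filter≡∑𝟙 _ pairs)
          (∑𝟙-none _ (All.universal (λ (x , y) (a , b , e) →
                         disjoint y (subst (A ∋_) (x∙y⁻¹≈ε⇒x≈y x y e) a , b)) pairs))

  -- Double counting: every pair in A × B has exactly one difference.
  ∑-external : (A B : Subset G) → ∑G (externalDiffCount A B) ≡ size A * size B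
  ∑-external A B = begin
    ∑G (externalDiffCount A B)                                  ≡⟨ ∑-cong (external≡∑∑ A B) elems ⟩
    ∑G (λ g → ∑G (λ x → ∑G (λ y → 𝟙 (diff? A B g x y))))        ≡⟨ ∑-swap _ elems elems ⟩
    ∑G (λ x → ∑G (λ g → ∑G (λ y → 𝟙 (diff? A B g x y))))        ≡⟨ ∑-cong (λ x → ∑-swap _ elems elems) elems ⟩
    ∑G (λ x → ∑G (λ y → ∑G (λ g → 𝟙 (diff? A B g x y))))
      ≡⟨ ∑-cong (λ x → ∑-cong (oneDifference x) elems) elems ⟩
    ∑G (λ x → ∑G (λ y → 𝟙 (A ∋? x) * 𝟙 (B ∋? y)))
      ≡⟨ ∑-cong (λ x → ∑-*ˡ (𝟙 (A ∋? x)) (λ y → 𝟙 (B ∋? y)) elems) elems ⟩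
    ∑G (λ x → 𝟙 (A ∋? x) * ∑G (λ y → 𝟙 (B ∋? y)))
      ≡⟨ ∑-*ʳ (λ x → 𝟙 (A ∋? x)) (∑G (λ y → 𝟙 (B ∋? y))) elems ⟩
    ∑G (λ x → 𝟙 (A ∋? x)) * ∑G (λ y → 𝟙 (B ∋? y))
      ≡⟨ cong₂ _*_ (size≡∑ A) (size≡∑ B) ⟨
    size A * size B                                             ∎
    where
    oneDifference : ∀ x y → ∑G (λ g → 𝟙 (diff? A B g x y)) ≡ 𝟙 (A ∋? x) * 𝟙 (B ∋? y)
    oneDifference x y = begin
      ∑G (λ g → 𝟙 (diff? A B g x y))  ≡⟨ ∑G𝟙-point (λ g → diff? A B g x y) (x - y) (λ _ (_ , _ , e) → sym e) ⟩
      𝟙 (diff? A B (x - y) x y)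
        ≡⟨ 𝟙-⇔ _ ((A ∋? x) ×-dec (B ∋? y)) (λ (a , b , _) → a , b) (λ (a , b) → a , b , refl) ⟩
      𝟙 ((A ∋? x) ×-dec (B ∋? y))     ≡⟨ 𝟙-× (A ∋? x) (B ∋? y) ⟩
      𝟙 (A ∋? x) * 𝟙 (B ∋? y)         ∎

  record Complementary (A B : Subset G) : Set where
    constructor complementary
    field
      disjoint : ∀ x → ¬ ((A ∋ x) × (B ∋ x))
      covers   : ∀ x → ((A ∋ x) ⊎ (B ∋ x)) ⇔ (x ≢ 0#)

  module _ {A B : Subset G} (A∣B : Complementary A B) where
    open Complementary A∣B renaming (covers to union)

    complementary-sym : Complementary B A
    complementary-sym = complementary (λ x (b , a) → disjoint x (a , b))
      (λ x → mk⇔ (Equivalence.to (union x) ∘ Sum.swap) (Sum.swap ∘ Equivalence.from (union x)))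

    0∉ : ¬ (A ∋ 0#)
    0∉ a = Equivalence.to (union 0#) (inj₁ a) refl

    whole-split : whole ≐ A ⊎ (B ∪ zeroSet)
    whole-split = disjointUnion (λ x (a , b⊎0) → Sum.[ (λ b → disjoint x (a , b)) , Equivalence.to (union x) (inj₁ a) ] b⊎0)
                                (λ x → mk⇔ (λ _ → cover x) (λ _ → tt))
      where
      cover : ∀ x → (A ∋ x) ⊎ ((B ∋ x) ⊎ (x ≡ 0#))
      cover x with x ≟ 0#
      ... | yes x≡0 = inj₂ (inj₂ x≡0)
      ... | no  x≢0 = Sum.map₂ inj₁ (Equivalence.from (union x) x≢0)

    rest-split : (B ∪ zeroSet) ≐ B ⊎ zeroSet
    rest-split = disjointUnion (λ x (b , x≡0) → 0∉B (subst (B ∋_) x≡0 b)) (λ x → mk⇔ id id)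
      where
      0∉B : ¬ (B ∋ 0#)
      0∉B b = Equivalence.to (union 0#) (inj₂ b) refl

    order-complementary : order ≡ size A + size B + 1
    order-complementary = begin
      order                          ≡⟨ size-whole ⟨
      size whole                     ≡⟨ size-⊎ whole-split ⟩
      size A + size (B ∪ zeroSet)    ≡⟨ cong (size A +_) (size-⊎ rest-split) ⟩
      size A + (size B + size zeroSet) ≡⟨ cong (λ k → size A + (size B + k)) size-zeroSet ⟩
      size A + (size B + 1)          ≡⟨ +-assoc (size A) (size B) 1 ⟨
      size A + size B + 1            ∎

    -- The basic counting identity: for g ≠ 0, each a ∈ A has a - g in
    -- exactly one of A, B, {0}, and the last happens iff a = g.
    counting-identity : ∀ {g} → g ≢ 0# →
      internalDiffCount A g + externalDiffCount A B g + 𝟙 (A ∋? g) ≡ size A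
    counting-identity {g} g≢0 = begin
      internalDiffCount A g + externalDiffCount A B g + 𝟙 (A ∋? g)
        ≡⟨ cong₂ (λ i z → i + externalDiffCount A B g + z) (internal≡external A g≢0) (sym (external-zeroSet A g)) ⟩
      externalDiffCount A A g + externalDiffCount A B g + externalDiffCount A zeroSet g
        ≡⟨ +-assoc (externalDiffCount A A g) _ _ ⟩
      externalDiffCount A A g + (externalDiffCount A B g + externalDiffCount A zeroSet g)
        ≡⟨ cong (externalDiffCount A A g +_) (external-⊎ʳ A rest-split g) ⟨
      externalDiffCount A A g + externalDiffCount A (B ∪ zeroSet) g
        ≡⟨ external-⊎ʳ A whole-split g ⟨
      externalDiffCount A whole g
        ≡⟨ external-whole A g ⟩
      size A ∎

  HasConstantExternal : Subset G → Subset G → ℕ → Set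
  HasConstantExternal A B n = ∀ g → g ≢ 0# → externalDiffCount A B g ≡ n

  -- E_{B,A}(g) = E_{A,B}(-g), so constancy passes from (A, B) to (B, A).
  constantExternal-swap : ∀ {A B n} → HasConstantExternal A B n → HasConstantExternal B A n
  constantExternal-swap {A} {B} const g g≢0 =
    trans (external-swap B A g) (const (- g) (neg≢0 g≢0))

  internal-neg : (A : Subset G) {g : Carrier} → g ≢ 0# → internalDiffCount A g ≡ internalDiffCount A (- g)
  internal-neg A {g} g≢0 = begin
    internalDiffCount A g      ≡⟨ internal≡external A g≢0 ⟩
    externalDiffCount A A g    ≡⟨ external-swap A A g ⟩
    externalDiffCount A A (- g) ≡⟨ internal≡external A (neg≢0 g≢0) ⟨
    internalDiffCount A (- g)  ∎

  module _ {A B : Subset G} (A∣B : Complementary A B) where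

    -- A constant external count makes A symmetric, A = -A: compare the
    -- counting identity at x and -x, using I_A(x) = I_A(-x).
    regular-of-constantExternal : ∀ {lam} → HasConstantExternal A B lam → IsRegular A
    regular-of-constantExternal {lam} const =
      0∉ A∣B , λ x → mk⇔ (𝟙-transfer _ _ (same x)) (𝟙-transfer _ _ (sym (same x)))
      where
      same : ∀ x → 𝟙 (A ∋? x) ≡ 𝟙 (A ∋? (- x))
      same x with x ≟ 0#
      ... | yes refl = cong (λ z → 𝟙 (A ∋? z)) (sym ε⁻¹≈ε)
      ... | no  x≢0  = +-cancelˡ-≡ (internalDiffCount A x + lam) _ _ (begin
        internalDiffCount A x + lam + 𝟙 (A ∋? x)
          ≡⟨ cong (λ e → internalDiffCount A x + e + 𝟙 (A ∋? x)) (const x x≢0) ⟨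
        internalDiffCount A x + externalDiffCount A B x + 𝟙 (A ∋? x)
          ≡⟨ counting-identity A∣B x≢0 ⟩
        size A
          ≡⟨ counting-identity A∣B (neg≢0 x≢0) ⟨
        internalDiffCount A (- x) + externalDiffCount A B (- x) + 𝟙 (A ∋? (- x))
          ≡⟨ cong₂ (λ i e → i + e + 𝟙 (A ∋? (- x))) (internal-neg A x≢0) (sym (const (- x) (neg≢0 x≢0))) ⟨
        internalDiffCount A x + lam + 𝟙 (A ∋? (- x)) ∎)

    -- With |A| = 2n the counting identity I + E + [g ∈ A] = 2n determines
    -- the internal count I(g) from the external count E(g) and vice versa.
    module Balance (n : ℕ) (|A|≡2n : size A ≡ 2 * n) {g : Carrier} (g≢0 : g ≢ 0#) where
      private
        I E : ℕ
        I = internalDiffCount A g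
        E = externalDiffCount A B g

        identity : I + E + 𝟙 (A ∋? g) ≡ 2 * n
        identity = trans (counting-identity A∣B g≢0) |A|≡2n

      balance-∈ : A ∋ g → (I ≡ n ∸ 1) ⇔ (E ≡ n)
      balance-∈ a = exchange I E (n ∸ 1) n
        (balance-in I E n (trans (cong (I + E +_) (sym (𝟙-yes (A ∋? g) a))) identity))

      balance-∉ : ¬ (A ∋ g) → (I ≡ n) ⇔ (E ≡ n)
      balance-∉ ¬a = exchange I E n n
        (balance-out I E n (trans (cong (I + E +_) (sym (𝟙-no (A ∋? g) ¬a))) identity))

    pds-of-constantExternal : ∀ n → size A ≡ 2 * n → HasConstantExternal A B n →
      IsPDS A order (2 * n) (n ∸ 1) n
    pds-of-constantExternal n |A|≡2n const =
      refl , |A|≡2n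
      , (λ g g≢0 a  → Equivalence.from (balance-∈ g≢0 a) (const g g≢0))
      , (λ g g≢0 ¬a → Equivalence.from (balance-∉ g≢0 ¬a) (const g g≢0))
      where open Balance n |A|≡2n

    constantExternal-of-pds : ∀ n → IsPDS A order (2 * n) (n ∸ 1) n → HasConstantExternal A B n
    constantExternal-of-pds n (_ , |A|≡2n , λ-count , μ-count) g g≢0 with A ∋? g
    ... | yes a = Equivalence.to (balance-∈ g≢0 a) (λ-count g g≢0 a)
      where open Balance n |A|≡2n
    ... | no ¬a = Equivalence.to (balance-∉ g≢0 ¬a) (μ-count g g≢0 ¬a)
      where open Balance n |A|≡2n

    paley-of-constantExternal : ∀ n → size A ≡ 2 * n → size B ≡ 2 * n →
      HasConstantExternal A B n → IsPaleyPDS A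
    paley-of-constantExternal n |A|≡2n |B|≡2n const =
      n
      , trans (order-complementary A∣B) (trans (cong₂ (λ a b → a + b + 1) |A|≡2n |B|≡2n) (twice+twice+1 n))
      , regular-of-constantExternal const
      , pds-of-constantExternal n |A|≡2n const

    𝟙-complementary : ∀ g → 𝟙 (A ∋? g) + 𝟙 (B ∋? g) ≡ 𝟙 (¬? (g ≟ 0#))
    𝟙-complementary g =
      trans (sym (𝟙-⊎ (A ∋? g) (B ∋? g) (λ a b → disjoint g (a , b))))
            (𝟙-⇔ _ (¬? (g ≟ 0#)) (Equivalence.to (covers g)) (Equivalence.from (covers g)))
      where open Complementary A∣B

    -- Double counting: Σ_g E(g) = |A||B|, while a constant external count
    -- λ contributes λ once for each of the |A| + |B| nonzero elements.
    external-total : ∀ lam → HasConstantExternal A B lam → size A * size B ≡ lam * (size A + size B)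
    external-total lam const = begin
      size A * size B                              ≡⟨ ∑-external A B ⟨
      ∑G (externalDiffCount A B)                   ≡⟨ ∑-cong pointwise elems ⟩
      ∑G (λ g → lam * (𝟙 (A ∋? g) + 𝟙 (B ∋? g)))   ≡⟨ ∑-*ˡ lam _ elems ⟩
      lam * ∑G (λ g → 𝟙 (A ∋? g) + 𝟙 (B ∋? g))     ≡⟨ cong (lam *_) (∑-+ _ _ elems) ⟩
      lam * (∑G (λ g → 𝟙 (A ∋? g)) + ∑G (λ g → 𝟙 (B ∋? g)))
        ≡⟨ cong (lam *_) (cong₂ _+_ (size≡∑ A) (size≡∑ B)) ⟨
      lam * (size A + size B)                      ∎
      where
      nonzeroCount : ∀ g → externalDiffCount A B g ≡ lam * 𝟙 (¬? (g ≟ 0#))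
      nonzeroCount g with g ≟ 0#
      ... | yes refl = trans (external-zero A B (Complementary.disjoint A∣B)) (sym (*-zeroʳ lam))
      ... | no  g≢0  = trans (const g g≢0) (sym (*-identityʳ lam))

      pointwise : ∀ g → externalDiffCount A B g ≡ lam * (𝟙 (A ∋? g) + 𝟙 (B ∋? g))
      pointwise g = trans (nonzeroCount g) (cong (lam *_) (sym (𝟙-complementary g)))

    external≤size : ∀ {g} → g ≢ 0# → externalDiffCount A B g ≤ size A
    external≤size {g} g≢0 =
      subst (externalDiffCount A B g ≤_) (counting-identity A∣B g≢0)
            (≤-trans (m≤n+m (externalDiffCount A B g) (internalDiffCount A g)) (m≤m+n _ (𝟙 (A ∋? g))))

    -- For |A| = |B| = s a constant external count is s/2 (for s = 0 it is
    -- vacuous: G = {0}, and we may take 0).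
    halve : ∀ s lam → size A ≡ s → size B ≡ s → HasConstantExternal A B lam →
      Σ ℕ λ n → s ≡ 2 * n × HasConstantExternal A B n
    halve s lam |A|≡s |B|≡s const
      with square-cancel s lam (subst₂ (λ a b → a * b ≡ lam * (a + b)) |A|≡s |B|≡s (external-total lam const))
    ... | inj₁ s≡0    =
      0 , s≡0 , λ g g≢0 → n≤0⇒n≡0 (subst (externalDiffCount A B g ≤_) (trans |A|≡s s≡0) (external≤size g≢0))
    ... | inj₂ s≡2lam = lam , s≡2lam , const

  constantExternal-of-sedf : ∀ {v k lam} (A B : Subset G) → IsSEDF v 2 k lam (pairFamily A B) → HasConstantExternal A B lam
  constantExternal-of-sedf A B (_ , _ , _ , _ , sums) g g≢0 = trans (sym (+-identityʳ _)) (sums Fin.zero g g≢0)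

  sedf-of-constantExternal : ∀ {A B k n} → Complementary A B → size A ≡ k → size B ≡ k →
    HasConstantExternal A B n → HasConstantExternal B A n → IsSEDF order 2 k n (pairFamily A B)
  sedf-of-constantExternal {A} {B} {k} {n} A∣B |A|≡k |B|≡k constAB constBA =
    refl , s≤s (s≤s z≤n) , disjoint , sizes , sums
    where
    open Complementary A∣B using () renaming (disjoint to A∩B≡∅)
    disjoint : ∀ i j → i ≢ j → ∀ x → ¬ ((pairFamily A B i ∋ x) × (pairFamily A B j ∋ x))
    disjoint Fin.zero       Fin.zero       i≢j = ⊥-elim (i≢j refl)
    disjoint Fin.zero       (Fin.suc Fin.zero) _ x = A∩B≡∅ x
    disjoint (Fin.suc Fin.zero) Fin.zero       _ x (b , a) = A∩B≡∅ x (a , b)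
    disjoint (Fin.suc Fin.zero) (Fin.suc Fin.zero) i≢j = ⊥-elim (i≢j refl)
    sizes : ∀ i → size (pairFamily A B i) ≡ k
    sizes Fin.zero           = |A|≡k
    sizes (Fin.suc Fin.zero) = |B|≡k
    sums : ∀ i g → g ≢ 0# →
      sum (map (λ j → externalDiffCount (pairFamily A B i) (pairFamily A B j) g)
               (filter (λ j → ¬? (j ≟ᶠ i)) (allFin 2))) ≡ n
    sums Fin.zero           g g≢0 = trans (+-identityʳ _) (constAB g g≢0)
    sums (Fin.suc Fin.zero) g g≢0 = trans (+-identityʳ _) (constBA g g≢0)

open FiniteAbelianGroup using (Carrier; 0#; order)
open Subset using (_∋_)

theorem4p6 : (G : FiniteAbelianGroup) (D₁ D₂ : Subset G) →
    size D₁ ≡ (order G ∸ 1) / 2 → size D₂ ≡ (order G ∸ 1) / 2 →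
    (∀ x → ¬ ((D₁ ∋ x) × (D₂ ∋ x))) →
    (∀ x → ((D₁ ∋ x) ⊎ (D₂ ∋ x)) ⇔ (x ≢ 0# G)) →
    ((Σ ℕ λ lam → IsSEDF (order G) 2 ((order G ∸ 1) / 2) lam (pairFamily D₁ D₂))
       ⇔ IsPaleyPDS D₁)
    × (IsPaleyPDS D₁ → IsPaleyPDS D₂)
theorem4p6 G D₁ D₂ |D₁|≡s |D₂|≡s disjoint covers = mk⇔ sedf⇒paley paley⇒sedf , paley₁⇒paley₂
  where
  open Differences G

  s : ℕ
  s = (order G ∸ 1) / 2

  D₁∣D₂ : Complementary D₁ D₂
  D₁∣D₂ = complementary disjoint covers

  sedf⇒paley : (Σ ℕ λ lam → IsSEDF (order G) 2 s lam (pairFamily D₁ D₂)) → IsPaleyPDS D₁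
  sedf⇒paley (lam , sedf) with halve D₁∣D₂ s lam |D₁|≡s |D₂|≡s (constantExternal-of-sedf D₁ D₂ sedf)
  ... | n , s≡2n , const = paley-of-constantExternal D₁∣D₂ n (trans |D₁|≡s s≡2n) (trans |D₂|≡s s≡2n) const

  paley⇒sedf : IsPaleyPDS D₁ → Σ ℕ λ lam → IsSEDF (order G) 2 s lam (pairFamily D₁ D₂)
  paley⇒sedf (n , _ , _ , pds) =
    n , sedf-of-constantExternal D₁∣D₂ |D₁|≡s |D₂|≡s const (constantExternal-swap {D₁} {D₂} {n} const)
    where
    const : HasConstantExternal D₁ D₂ n
    const = constantExternal-of-pds D₁∣D₂ n pds

  paley₁⇒paley₂ : IsPaleyPDS D₁ → IsPaleyPDS D₂
  paley₁⇒paley₂ (n , _ , _ , pds@(_ , |D₁|≡2n , _)) =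
    paley-of-constantExternal (complementary-sym D₁∣D₂) n (trans |D₂|≡s (trans (sym |D₁|≡s) |D₁|≡2n)) |D₁|≡2n
      (constantExternal-swap {D₁} {D₂} {n} (constantExternal-of-pds D₁∣D₂ n pds))
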